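{- Let $V_0\in\mathbb{R}[x_1,\ldots,x_N]$ be a homogeneous polynomial of degree $d$ and let $\partial_j=\partial/\partial x_j$ for $j=0,\ldots,N$. There is a unique polynomial $V\in\mathbb{R}[x_0,x_1,\ldots,x_N]$ such that \[(\partial_1-\partial_0)(\partial_2-\partial_0)V=0,\] $V|_{x_0=0}=V_0$, and the coefficient of $x_0^1$ in $V$ (as a polynomial in $x_0$ with coefficients in $\mathbb{R}[x_1,\ldots,x_N]$) is $0$. It is given by $V=DV_0$, where \[D=\frac{\partial_1e^{x_0\partial_2}-\partial_2e^{x_0\partial_1}}{\partial_1-\partial_2}=1-\sum_{m=2}^\infty\frac{x_0^m}{m!}\sum_{\substack{\alpha_1,\alpha_2\ge 1\\ \alpha_1+\alpha_2=m}}\partial_1^{\alpha_1}\partial_2^{\alpha_2}.\] -}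

module Defs where

open import Level using (Level; _⊔_) renaming (suc to lsuc)
open import Algebra.Bundles using (CommutativeRing)
open import Data.Nat using (ℕ; zero; suc; _<_; _∸_)
open import Data.Nat.Base using (_!)
open import Data.Fin using (Fin) renaming (zero to fzero; suc to fsuc)
open import Data.Vec using (Vec; _∷_; lookup; updateAt; sum)
open import Data.Product using (∃; ∃-syntax; _×_)
open import Relation.Binary.PropositionalEquality using (_≡_)
open import Relation.Nullary using (¬_)

natCast : {c ℓ : Level} (R : CommutativeRing c ℓ) → ℕ → CommutativeRing.Carrier R
natCast R zero    = CommutativeRing.0# R
natCast R (suc n) = CommutativeRing._+_ R (CommutativeRing.1# R) (natCast R n)

-- A field of characteristic zero (e.g. ℝ), given as a commutative ring
-- with 1 ≠ 0, inverses of nonzero elements, and n·1 ≠ 0 for n ≥ 1.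
record CharZeroField (c ℓ : Level) : Set (lsuc (c ⊔ ℓ)) where
  field
    commRing : CommutativeRing c ℓ
  open CommutativeRing commRing public
  ⟦_⟧ : ℕ → Carrier
  ⟦_⟧ = natCast commRing
  field
    1≉0      : ¬ (1# ≈ 0#)
    inv      : (x : Carrier) → ¬ (x ≈ 0#) → Carrier
    inv-r    : (x : Carrier) (p : ¬ (x ≈ 0#)) → x * inv x p ≈ 1#
    charZero : (n : ℕ) → ¬ (⟦ suc n ⟧ ≈ 0#)

module Poly {c ℓ : Level} (F : CharZeroField c ℓ) where
  open CharZeroField F public

  -- A (potential) polynomial in k variables x_0..x_{k-1} is given by its
  -- coefficient function on exponent vectors (monomials).
  Pol : ℕ → Set c
  Pol k = Vec ℕ k → Carrier

  IsPoly : {k : ℕ} → Pol k → Set ℓ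
  IsPoly {k} p = ∃[ B ] ((α : Vec ℕ k) → (∃[ i ] (B < lookup α i)) → p α ≈ 0#)

  Homogeneous : {k : ℕ} → ℕ → Pol k → Set ℓ
  Homogeneous {k} d p = (α : Vec ℕ k) → ¬ (sum α ≡ d) → p α ≈ 0#

  -- partial derivative with respect to x_j :  ∂_j x^α = α_j x^(α - e_j)
  ∂ : {k : ℕ} → Fin k → Pol k → Pol k
  ∂ j p α = ⟦ suc (lookup α j) ⟧ * p (updateAt α j suc)

  ∂^ : {k : ℕ} → Fin k → ℕ → Pol k → Pol k
  ∂^ j zero    p = p
  ∂^ j (suc a) p = ∂ j (∂^ j a p)

  _⊖_ : {k : ℕ} → Pol k → Pol k → Pol k
  (p ⊖ q) α = p α - q α

  invFact : ℕ → Carrier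
  invFact m = go (m !)
    where
    go : ℕ → Carrier
    go zero    = 0#            -- never used: m! ≠ 0
    go (suc n) = inv ⟦ suc n ⟧ (charZero n)

  sum1to : ℕ → (ℕ → Carrier) → Carrier
  sum1to zero    f = 0#
  sum1to (suc n) f = f (suc n) + sum1to n f

  -- Variables of R[x_0, x_1, ..., x_N] with N = 2 + n are Fin (suc (suc (suc n))):
  -- index 0 is x_0, index 1 is x_1, index 2 is x_2.
  -- Variables of R[x_1, ..., x_N] are Fin (suc (suc n)): index 0 is x_1, index 1 is x_2.

  -- The operator D applied to V₀:
  -- D V₀ = V₀ - Σ_{m ≥ 2} x_0^m / m! Σ_{α₁,α₂ ≥ 1, α₁+α₂=m} ∂_1^α₁ ∂_2^α₂ V₀
  -- written coefficientwise in powers of x_0.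
  DV : {n : ℕ} → Pol (suc (suc n)) → Pol (suc (suc (suc n)))
  DV V₀ (zero ∷ β)          = V₀ β
  DV V₀ (suc zero ∷ β)      = 0#
  DV V₀ (suc (suc k) ∷ β)   =
    - (invFact (suc (suc k)) *
       sum1to (suc k) (λ a → ∂^ fzero a (∂^ (fsuc fzero) (suc (suc k) ∸ a) V₀) β))

  Conditions : {n : ℕ} → Pol (suc (suc n)) → Pol (suc (suc (suc n))) → Set ℓ
  Conditions {n} V₀ V =
    ((α : Vec ℕ (suc (suc (suc n)))) →
       (∂ (fsuc fzero) W ⊖ ∂ fzero W) α ≈ 0#)
    × ((β : Vec ℕ (suc (suc n))) → V (0 ∷ β) ≈ V₀ β)
    × ((β : Vec ℕ (suc (suc n))) → V (1 ∷ β) ≈ 0#)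
    where
    W : Pol (suc (suc (suc n)))
    W = ∂ (fsuc (fsuc fzero)) V ⊖ ∂ fzero V

-- Write V = Σₘ (x₀ᵐ / m!) sₘ with sₘ ∈ R[x₁, …, x_N]. On such series ∂₀ acts as the shift
-- (sₘ)ₘ ↦ (sₘ₊₁)ₘ and ∂ⱼ (j ≥ 1) acts termwise, so ∂ⱼ − ∂₀ becomes Δ j and the equation becomes
-- Δ₁ (Δ₂ s) = 0. A sequence u is determined by u₀ and Δ u; applied to Δ₂ s and then to s, this
-- shows that s is determined by s₀ = V₀ and s₁ = 0. For D the coefficients are
-- sₘ = (∂₁∂₂ᵐ − ∂₂∂₁ᵐ) / (∂₁ − ∂₂) V₀, so Δ₂ s = (∂₁ᵐ ∂₂ V₀)ₘ, a geometric sequence killed by Δ₁.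
-- D V₀ is a polynomial because all its monomials have degree d, like those of V₀.
module Submission where

open import Defs
open import Level using (Level)
open import Data.Nat using (ℕ; zero; suc; _∸_; _≤_; _<_; _!)
open import Data.Vec using (Vec; _∷_; lookup; updateAt; sum)
open import Data.Product using (_×_; _,_; ∃-syntax)

import Data.Nat as ℕ
import Data.Nat.Properties as ℕₚ
open import Data.Nat.Properties
  using (≤-refl; ≤-trans; m≤n⇒m≤1+n; m≤m+n; m≤n+m; <-≤-trans; >⇒≢; +-suc; 1≤n!;
         +-∸-assoc; m+n∸n≡m; m∸n+n≡m)
open import Data.Fin as Fin using (Fin) renaming (zero to fzero; suc to fsuc)
open import Data.Vec.Properties using (lookup∘updateAt′; updateAt-commutes)
open import Function using (_∘_)
open import Relation.Binary.PropositionalEquality as ≡ using (_≡_)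
open import Relation.Nullary using (¬_; yes; no)
import Algebra.Properties.Ring as RingProperties
import Algebra.Properties.CommutativeSemigroup as CommutativeSemigroupProperties
import Algebra.Properties.Semiring.Mult as SemiringMult

module _ {c ℓ : Level} (F : CharZeroField c ℓ) where
  open Poly F
  open RingProperties ring
    using (-‿distribʳ-*; x[y-z]≈xy-xz; +-cancelˡ; -‿injective; -‿involutive; -0#≈0#; //-rightDividesʳ)
  open CommutativeSemigroupProperties *-commutativeSemigroup using (x∙yz≈y∙xz; x∙yz≈yx∙z)
  open SemiringMult semiring using (×1-homo-*) renaming (_×_ to _·_)
  open import Relation.Binary.Reasoning.Setoid setoid

  private variable
    k : ℕ

  ⟦⟧-homo-* : ∀ m n → ⟦ m ℕ.* n ⟧ ≈ ⟦ m ⟧ * ⟦ n ⟧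
  ⟦⟧-homo-* m n = trans (⟦⟧≈·1 (m ℕ.* n)) (trans (×1-homo-* m n) (sym (*-cong (⟦⟧≈·1 m) (⟦⟧≈·1 n))))
    where
    ⟦⟧≈·1 : ∀ m → ⟦ m ⟧ ≈ m · 1#
    ⟦⟧≈·1 zero    = refl
    ⟦⟧≈·1 (suc m) = +-congˡ (⟦⟧≈·1 m)

  ⟦!⟧*invFact : ∀ m → ⟦ m ! ⟧ * invFact m ≈ 1#
  ⟦!⟧*invFact m with m ! | 1≤n! m
  ... | suc k | _ = inv-r ⟦ suc k ⟧ (charZero k)

  *-inverse-unique : ∀ {x y z} → x * y ≈ 1# → x * z ≈ 1# → y ≈ z
  *-inverse-unique {x} {y} {z} xy≈1 xz≈1 = begin
    y            ≈⟨ *-identityʳ y ⟨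
    y * 1#       ≈⟨ *-congˡ xz≈1 ⟨
    y * (x * z)  ≈⟨ *-assoc y x z ⟨
    (y * x) * z  ≈⟨ *-congʳ (trans (*-comm y x) xy≈1) ⟩
    1# * z       ≈⟨ *-identityˡ z ⟩
    z            ∎

  ⟦suc⟧*invFact-suc : ∀ m → ⟦ suc m ⟧ * invFact (suc m) ≈ invFact m
  ⟦suc⟧*invFact-suc m = *-inverse-unique (begin
    ⟦ m ! ⟧ * (⟦ suc m ⟧ * invFact (suc m))  ≈⟨ x∙yz≈yx∙z _ _ _ ⟩
    (⟦ suc m ⟧ * ⟦ m ! ⟧) * invFact (suc m)  ≈⟨ *-congʳ (⟦⟧-homo-* (suc m) (m !)) ⟨
    ⟦ suc m ! ⟧ * invFact (suc m)            ≈⟨ ⟦!⟧*invFact (suc m) ⟩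
    1#                                       ∎) (⟦!⟧*invFact m)

  invFact-zero : invFact 0 ≈ 1#
  invFact-zero = *-inverse-unique (⟦!⟧*invFact 0) (trans (*-identityʳ _) (+-identityʳ 1#))

  invFact-cancel : ∀ m {x} → invFact m * x ≈ 0# → x ≈ 0#
  invFact-cancel m {x} ix≈0 = begin
    x                          ≈⟨ *-identityˡ x ⟨
    1# * x                     ≈⟨ *-congʳ (⟦!⟧*invFact m) ⟨
    (⟦ m ! ⟧ * invFact m) * x  ≈⟨ *-assoc _ _ _ ⟩
    ⟦ m ! ⟧ * (invFact m * x)  ≈⟨ *-congˡ ix≈0 ⟩
    ⟦ m ! ⟧ * 0#               ≈⟨ zeroʳ _ ⟩
    0#                         ∎

  infix 4 _≋_
  _≋_ : Pol k → Pol k → Set ℓ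
  p ≋ q = ∀ α → p α ≈ q α

  0ₚ : Pol k
  0ₚ _ = 0#

  ∂-cong : ∀ (j : Fin k) {p q} → p ≋ q → ∂ j p ≋ ∂ j q
  ∂-cong j p≋q α = *-congˡ (p≋q (updateAt α j suc))

  ∂-comm : ∀ (i j : Fin k) p → ∂ i (∂ j p) ≋ ∂ j (∂ i p)
  ∂-comm i j p α with i Fin.≟ j
  ... | yes ≡.refl = refl
  ... | no i≢j = begin
    ⟦ suc (lookup α i) ⟧ * (⟦ suc (lookup (updateAt α i suc) j) ⟧ * p (updateAt (updateAt α i suc) j suc))
      ≡⟨ ≡.cong₂ (λ a γ → ⟦ suc (lookup α i) ⟧ * (⟦ suc a ⟧ * p γ))
                 (lookup∘updateAt′ j i (i≢j ∘ ≡.sym) α) (updateAt-commutes j i (i≢j ∘ ≡.sym) α) ⟩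
    ⟦ suc (lookup α i) ⟧ * (⟦ suc (lookup α j) ⟧ * p (updateAt (updateAt α j suc) i suc))
      ≈⟨ x∙yz≈y∙xz _ _ _ ⟩
    ⟦ suc (lookup α j) ⟧ * (⟦ suc (lookup α i) ⟧ * p (updateAt (updateAt α j suc) i suc))
      ≡⟨ ≡.cong (λ a → ⟦ suc (lookup α j) ⟧ * (⟦ suc a ⟧ * p (updateAt (updateAt α j suc) i suc)))
                (lookup∘updateAt′ i j i≢j α) ⟨
    ⟦ suc (lookup α j) ⟧ * (⟦ suc (lookup (updateAt α j suc) i) ⟧ * p (updateAt (updateAt α j suc) i suc))
      ∎

  ∂^-comm : ∀ (i j : Fin k) a p → ∂^ i a (∂ j p) ≋ ∂ j (∂^ i a p)
  ∂^-comm i j zero    p = λ _ → refl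
  ∂^-comm i j (suc a) p α = trans (∂-cong i (∂^-comm i j a p) α) (∂-comm i j (∂^ i a p) α)

  sum1to-cong : ∀ m {f g : ℕ → Carrier} → (∀ a → a ≤ m → f a ≈ g a) → sum1to m f ≈ sum1to m g
  sum1to-cong zero    _   = refl
  sum1to-cong (suc m) f≈g = +-cong (f≈g (suc m) ≤-refl) (sum1to-cong m λ a a≤m → f≈g a (m≤n⇒m≤1+n a≤m))

  sum1to-zero : ∀ m {f : ℕ → Carrier} → (∀ a → a ≤ m → f a ≈ 0#) → sum1to m f ≈ 0#
  sum1to-zero zero    _    = refl
  sum1to-zero (suc m) f≈0 =
    trans (+-cong (f≈0 (suc m) ≤-refl) (sum1to-zero m λ a a≤m → f≈0 a (m≤n⇒m≤1+n a≤m))) (+-identityʳ 0#)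

  ∂-sum1to : ∀ (j : Fin k) m (f : ℕ → Pol k) →
             ∂ j (λ γ → sum1to m (λ a → f a γ)) ≋ (λ α → sum1to m (λ a → ∂ j (f a) α))
  ∂-sum1to j zero    f α = zeroʳ _
  ∂-sum1to j (suc m) f α = trans (distribˡ _ _ _) (+-congˡ (∂-sum1to j m f α))

  sum-updateAt-suc : ∀ (α : Vec ℕ k) j → sum (updateAt α j suc) ≡ suc (sum α)
  sum-updateAt-suc (a ∷ α) fzero    = ≡.refl
  sum-updateAt-suc (a ∷ α) (fsuc j) = ≡.trans (≡.cong (a ℕ.+_) (sum-updateAt-suc α j)) (+-suc a (sum α))

  lookup≤sum : ∀ (α : Vec ℕ k) i → lookup α i ≤ sum α
  lookup≤sum (a ∷ α) fzero    = m≤m+n a (sum α)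
  lookup≤sum (a ∷ α) (fsuc i) = ≤-trans (lookup≤sum α i) (m≤n+m (sum α) a)

  DegreesIn : (ℕ → Set) → Pol k → Set ℓ
  DegreesIn P p = ∀ α → ¬ P (sum α) → p α ≈ 0#

  ∂^-degreesIn : ∀ (j : Fin k) a P {p} → DegreesIn P p → DegreesIn (λ e → P (a ℕ.+ e)) (∂^ j a p)
  ∂^-degreesIn j zero    P p∈P = p∈P
  ∂^-degreesIn j (suc a) P p∈P α ¬P[1+a+e] =
    trans (*-congˡ (∂^-degreesIn j a P p∈P (updateAt α j suc) ¬P[a+e′])) (zeroʳ _)
    where
    ¬P[a+e′] : ¬ P (a ℕ.+ sum (updateAt α j suc))
    ¬P[a+e′] = ≡.subst (¬_ ∘ P)
      (≡.sym (≡.trans (≡.cong (a ℕ.+_) (sum-updateAt-suc α j)) (+-suc a (sum α)))) ¬P[1+a+e]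

  egf : (ℕ → Pol k) → Pol (suc k)
  egf s (m ∷ β) = invFact m * s m β

  egfCoeff : Pol (suc k) → ℕ → Pol k
  egfCoeff V m β = ⟦ m ! ⟧ * V (m ∷ β)

  egf-cong : ∀ {s s' : ℕ → Pol k} → (∀ m → s m ≋ s' m) → egf s ≋ egf s'
  egf-cong s≋s' (m ∷ β) = *-congˡ (s≋s' m β)

  egf-egfCoeff : ∀ (V : Pol (suc k)) → V ≋ egf (egfCoeff V)
  egf-egfCoeff V (m ∷ β) = begin
    V (m ∷ β)                            ≈⟨ *-identityˡ _ ⟨
    1# * V (m ∷ β)                       ≈⟨ *-congʳ (trans (*-comm _ _) (⟦!⟧*invFact m)) ⟨
    (invFact m * ⟦ m ! ⟧) * V (m ∷ β)    ≈⟨ *-assoc _ _ _ ⟩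
    invFact m * (⟦ m ! ⟧ * V (m ∷ β))    ∎

  Δ : Fin k → (ℕ → Pol k) → ℕ → Pol k
  Δ j s m = ∂ j (s m) ⊖ s (suc m)

  Δ-cong : ∀ (j : Fin k) {s s'} m → s m ≋ s' m → s (suc m) ≋ s' (suc m) → Δ j s m ≋ Δ j s' m
  Δ-cong j m sₘ≋ sₘ₊₁≋ α = +-cong (∂-cong j sₘ≋ α) (-‿cong (sₘ₊₁≋ α))

  Δ-∂^ : ∀ (j : Fin k) q m → Δ j (λ a → ∂^ j a q) m ≋ 0ₚ
  Δ-∂^ j q m α = -‿inverseʳ _

  Δ-unique : ∀ (j : Fin k) {s s'} → (∀ m → Δ j s m ≋ Δ j s' m) → s 0 ≋ s' 0 → ∀ m → s m ≋ s' m
  Δ-unique j Δs≋Δs' s₀≋s'₀ zero    = s₀≋s'₀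
  Δ-unique j {s} {s'} Δs≋Δs' s₀≋s'₀ (suc m) α = -‿injective (+-cancelˡ _ _ _
    (trans (Δs≋Δs' m α) (+-congʳ (∂-cong j {s' m} {s m} (λ β → sym (Δ-unique j Δs≋Δs' s₀≋s'₀ m β)) α))))

  ∂-∂₀ : Fin k → Pol (suc k) → Pol (suc k)
  ∂-∂₀ j V = ∂ (fsuc j) V ⊖ ∂ fzero V

  ∂-∂₀-cong : ∀ (j : Fin k) {V V'} → V ≋ V' → ∂-∂₀ j V ≋ ∂-∂₀ j V'
  ∂-∂₀-cong j V≋V' α = +-cong (∂-cong (fsuc j) V≋V' α) (-‿cong (∂-cong fzero V≋V' α))

  ∂-∂₀-egf : ∀ (j : Fin k) s → ∂-∂₀ j (egf s) ≋ egf (Δ j s)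
  ∂-∂₀-egf j s (m ∷ β) = begin
    K * (invFact m * x) - ⟦ suc m ⟧ * (invFact (suc m) * y)
      ≈⟨ +-cong (x∙yz≈y∙xz K _ x) (-‿cong (trans (sym (*-assoc _ _ y)) (*-congʳ (⟦suc⟧*invFact-suc m)))) ⟩
    invFact m * (K * x) - invFact m * y
      ≈⟨ x[y-z]≈xy-xz (invFact m) _ y ⟨
    invFact m * (K * x - y) ∎
    where
    K = ⟦ suc (lookup β j) ⟧
    x = s m (updateAt β j suc)
    y = s (suc m) β

  module _ {n : ℕ} (V₀ : Pol (suc (suc n))) where

    x₁ x₂ : Fin (suc (suc n))
    x₁ = fzero
    x₂ = fsuc fzero

    Equation : Pol (suc (suc (suc n))) → Set ℓ
    Equation V = ∀ α → ∂-∂₀ x₁ (∂-∂₀ x₂ V) α ≈ 0#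

    CoeffEquation : (ℕ → Pol (suc (suc n))) → Set ℓ
    CoeffEquation s = ∀ m → Δ x₁ (Δ x₂ s) m ≋ 0ₚ

    ∂-∂₀²-egf : ∀ s → ∂-∂₀ x₁ (∂-∂₀ x₂ (egf s)) ≋ egf (Δ x₁ (Δ x₂ s))
    ∂-∂₀²-egf s α = trans (∂-∂₀-cong x₁ (∂-∂₀-egf x₂ s) α) (∂-∂₀-egf x₁ (Δ x₂ s) α)

    Equation-cong : ∀ {V V'} → V ≋ V' → Equation V → Equation V'
    Equation-cong V≋V' eq α = trans (sym (∂-∂₀-cong x₁ (∂-∂₀-cong x₂ V≋V') α)) (eq α)

    egf-equation : ∀ {s} → CoeffEquation s → Equation (egf s)
    egf-equation {s} eqₛ (m ∷ β) = trans (∂-∂₀²-egf s (m ∷ β)) (trans (*-congˡ (eqₛ m β)) (zeroʳ _))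

    egfCoeff-equation : ∀ V → Equation V → CoeffEquation (egfCoeff V)
    egfCoeff-equation V eq m β = invFact-cancel m
      (trans (sym (∂-∂₀²-egf (egfCoeff V) (m ∷ β))) (Equation-cong (egf-egfCoeff V) eq (m ∷ β)))

    solution-unique : ∀ {V V'} → Conditions V₀ V → Conditions V₀ V' → V ≋ V'
    solution-unique {V} {V'} (eq , at0 , at1) (eq' , at0' , at1') α = begin
      V α          ≈⟨ egf-egfCoeff V α ⟩
      egf s α      ≈⟨ egf-cong s≋s' α ⟩
      egf s' α     ≈⟨ egf-egfCoeff V' α ⟨
      V' α         ∎
      where
      s s' : ℕ → Pol (suc (suc n))
      s  = egfCoeff V
      s' = egfCoeff V'
      s₀≋s'₀ : s 0 ≋ s' 0
      s₀≋s'₀ β = *-congˡ (trans (at0 β) (sym (at0' β)))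
      s₁≋s'₁ : s 1 ≋ s' 1
      s₁≋s'₁ β = *-congˡ (trans (at1 β) (sym (at1' β)))
      Δ₂s≋Δ₂s' : ∀ m → Δ x₂ s m ≋ Δ x₂ s' m
      Δ₂s≋Δ₂s' = Δ-unique x₁
        (λ m β → trans (egfCoeff-equation V eq m β) (sym (egfCoeff-equation V' eq' m β)))
        (Δ-cong x₂ {s} {s'} 0 s₀≋s'₀ s₁≋s'₁)
      s≋s' : ∀ m → s m ≋ s' m
      s≋s' = Δ-unique x₂ Δ₂s≋Δ₂s' s₀≋s'₀

    mixedPartials : ℕ → Pol (suc (suc n))
    mixedPartials m β = sum1to (suc m) (λ a → ∂^ x₁ a (∂^ x₂ (suc (suc m) ∸ a) V₀) β)

    mixedPartials-suc : ∀ m →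
      mixedPartials (suc m) ≋ λ β → ∂^ x₁ (suc (suc m)) (∂ x₂ V₀) β + ∂ x₂ (mixedPartials m) β
    mixedPartials-suc m β =
      +-cong highest (trans (sum1to-cong (suc m) lower) (sym (∂-sum1to x₂ (suc m) term β)))
      where
      term : ℕ → Pol (suc (suc n))
      term a = ∂^ x₁ a (∂^ x₂ (suc (suc m) ∸ a) V₀)
      highest : ∂^ x₁ (suc (suc m)) (∂^ x₂ (suc m ∸ m) V₀) β ≈ ∂^ x₁ (suc (suc m)) (∂ x₂ V₀) β
      highest = reflexive (≡.cong (λ b → ∂^ x₁ (suc (suc m)) (∂^ x₂ b V₀) β) (m+n∸n≡m 1 m))
      lower : ∀ a → a ≤ suc m → ∂^ x₁ a (∂^ x₂ (suc (suc (suc m)) ∸ a) V₀) β ≈ ∂ x₂ (term a) β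
      lower a a≤1+m = trans
        (reflexive (≡.cong (λ b → ∂^ x₁ a (∂^ x₂ b V₀) β) (+-∸-assoc 1 (m≤n⇒m≤1+n a≤1+m))))
        (∂^-comm x₁ x₂ a (∂^ x₂ (suc (suc m) ∸ a) V₀) β)

    D-coeff : ℕ → Pol (suc (suc n))
    D-coeff zero          = V₀
    D-coeff (suc zero)    = 0ₚ
    D-coeff (suc (suc m)) = λ β → - mixedPartials m β

    DV≋egf-D-coeff : DV V₀ ≋ egf D-coeff
    DV≋egf-D-coeff (zero ∷ β)          = sym (trans (*-congʳ invFact-zero) (*-identityˡ _))
    DV≋egf-D-coeff (suc zero ∷ β)      = sym (zeroʳ _)
    DV≋egf-D-coeff (suc (suc m) ∷ β)   = -‿distribʳ-* _ _

    Δ₂-D-coeff : ∀ m → Δ x₂ D-coeff m ≋ ∂^ x₁ m (∂ x₂ V₀)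
    Δ₂-D-coeff zero β = trans (+-congˡ -0#≈0#) (+-identityʳ _)
    Δ₂-D-coeff (suc zero) β = begin
      ⟦ suc (lookup β x₂) ⟧ * 0# - - (X + 0#)  ≈⟨ +-cong (zeroʳ _) (-‿involutive _) ⟩
      0# + (X + 0#)                           ≈⟨ +-identityˡ _ ⟩
      X + 0#                                  ≈⟨ +-identityʳ X ⟩
      X                                       ∎
      where X = ∂ x₁ (∂ x₂ V₀) β
    Δ₂-D-coeff (suc (suc m)) β = begin
      ⟦ suc (lookup β x₂) ⟧ * - mixedPartials m (updateAt β x₂ suc) - - mixedPartials (suc m) β
        ≈⟨ +-cong (sym (-‿distribʳ-* _ _)) (-‿involutive _) ⟩
      - ∂ x₂ (mixedPartials m) β + mixedPartials (suc m) β
        ≈⟨ +-comm _ _ ⟩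
      mixedPartials (suc m) β - ∂ x₂ (mixedPartials m) β
        ≈⟨ +-congʳ (mixedPartials-suc m β) ⟩
      ∂^ x₁ (suc (suc m)) (∂ x₂ V₀) β + ∂ x₂ (mixedPartials m) β - ∂ x₂ (mixedPartials m) β
        ≈⟨ //-rightDividesʳ _ _ ⟩
      ∂^ x₁ (suc (suc m)) (∂ x₂ V₀) β ∎

    conditions-DV : Conditions V₀ (DV V₀)
    conditions-DV = equation , (λ _ → refl) , (λ _ → refl)
      where
      coeffEquation : CoeffEquation D-coeff
      coeffEquation m β = trans
        (Δ-cong x₁ {Δ x₂ D-coeff} {λ a → ∂^ x₁ a (∂ x₂ V₀)} m (Δ₂-D-coeff m) (Δ₂-D-coeff (suc m)) β)
        (Δ-∂^ x₁ (∂ x₂ V₀) m β)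
      equation : Equation (DV V₀)
      equation = Equation-cong (λ α → sym (DV≋egf-D-coeff α)) (egf-equation coeffEquation)

    DV-finiteSupport : ∀ {d} → Homogeneous d V₀ → ∀ α → ∃[ i ] (d < lookup α i) → DV V₀ α ≈ 0#
    DV-finiteSupport {d} homogeneous α (i , d<αᵢ) = vanishes α (<-≤-trans d<αᵢ (lookup≤sum α i))
      where
      vanishes : ∀ α → d < sum α → DV V₀ α ≈ 0#
      vanishes (zero ∷ β)          d<|β| = homogeneous β (>⇒≢ d<|β|)
      vanishes (suc zero ∷ β)      _     = refl
      vanishes (suc (suc m) ∷ β)   d<|α| =
        trans (-‿cong (trans (*-congˡ (sum1to-zero (suc m) term≈0)) (zeroʳ _))) -0#≈0#
        where
        term≈0 : ∀ a → a ≤ suc m → ∂^ x₁ a (∂^ x₂ (suc (suc m) ∸ a) V₀) β ≈ 0#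
        term≈0 a a≤1+m =
          ∂^-degreesIn x₁ a (λ e → b ℕ.+ e ≡ d) (∂^-degreesIn x₂ b (_≡ d) homogeneous) β
          (>⇒≢ d<|α| ∘ ≡.trans (≡.trans (≡.cong (ℕ._+ sum β) (≡.sym (m∸n+n≡m (m≤n⇒m≤1+n a≤1+m))))
                                        (ℕₚ.+-assoc b a (sum β))))
          where b = suc (suc m) ∸ a

-- IsPoly V₀ follows from homogeneity, and uniqueness holds among all coefficient functions V,
-- so both IsPoly hypotheses go unused.
lemma4p6 : {c ℓ : Level} (F : CharZeroField c ℓ) → let open Poly F in
    (n d : ℕ) (V₀ : Pol (suc (suc n))) → IsPoly V₀ → Homogeneous d V₀ →
    (IsPoly (DV V₀) × Conditions V₀ (DV V₀))
    × ((V : Pol (suc (suc (suc n)))) → IsPoly V → Conditions V₀ V → (α : Vec ℕ (suc (suc (suc n)))) → V α ≈ DV V₀ α)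
lemma4p6 F n d V₀ _ homogeneous =
    ((d , DV-finiteSupport F V₀ homogeneous) , conditions-DV F V₀)
  , λ V _ conditions → solution-unique F V₀ conditions (conditions-DV F V₀)
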